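{- Let $R$ be a unique factorization domain with quotient field $Q(R)$, and let $f(s)=\frac{a_m}{m^s}+\cdots+\frac{a_n}{n^s}$ be an algebraically primitive Dirichlet polynomial with coefficients in $R$, $a_ma_n\neq0$. Suppose that for a prime element $p$ of $R$ either (i) $p\mid a_i$ for each $i=m,\dots,n-1$, $p\nmid a_n$ and $p^2\nmid a_m$; or (ii) $p\mid a_i$ for each $i=m+1,\dots,n$, $p\nmid a_m$ and $p^2\nmid a_n$. Then $f$ is irreducible over $Q(R)$.
   Context: Dirichlet polynomials $\sum_i \frac{a_i}{i^s}$ (finite sums, $i$ positive integers) are multiplied by the Dirichlet product $\left(\sum_j\frac{b_j}{j^s}\right)\left(\sum_k\frac{c_k}{k^s}\right)=\sum_i\frac{\sum_{jk=i}b_jc_k}{i^s}$; a constant Dirichlet polynomial is one supported on $\{1\}$. $f$ is algebraically primitive if the indices $i$ with $a_i\neq0$ have gcd $1$. "Irreducible over $Q(R)$" means $f$ cannot be written as a product of two nonconstant Dirichlet polynomials with coefficients in $Q(R)$. -}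

module Defs where

open import Level using (Level; _⊔_)
open import Data.Nat.Base as ℕ using (ℕ; zero; suc)
import Data.Nat.Properties as ℕP
open import Data.Product.Base using (Σ; ∃; _×_; _,_)
open import Data.List.Base using (List; foldr)
open import Data.List.Relation.Binary.Permutation.Propositional using (_↭_)
open import Data.List.Relation.Binary.Pointwise using (Pointwise)
open import Data.List.Relation.Unary.All using (All)
open import Data.Sum.Base using (_⊎_)
open import Relation.Nullary using (¬_; yes; no)
open import Relation.Binary.PropositionalEquality using (_≡_; _≢_)
open import Algebra.Bundles using (CommutativeRing; RawRing)

module _ {c ℓ} (R : CommutativeRing c ℓ) where
  open CommutativeRing R renaming (Carrier to A)
  open import Algebra.Definitions.RawSemiring (RawRing.rawSemiring (CommutativeRing.rawRing R))
    using (_∣_; Irreducible)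

  IsUnit : A → Set (c ⊔ ℓ)
  IsUnit u = u ∣ 1#

  Associated : A → A → Set (c ⊔ ℓ)
  Associated a b = ∃ λ u → IsUnit u × (a ≈ u * b)

  prod : List A → A
  prod = foldr _*_ 1#

  record IsUFD : Set (c ⊔ ℓ) where
    field
      1≉0            : ¬ (1# ≈ 0#)
      noZeroDivisors : ∀ {a b} → a * b ≈ 0# → a ≈ 0# ⊎ b ≈ 0#
      factorization  : ∀ a → ¬ (a ≈ 0#) → ¬ IsUnit a →
                       Σ (List A) λ xs → All Irreducible xs × (prod xs ≈ a)
      uniqueness     : ∀ xs ys → All Irreducible xs → All Irreducible ys →
                       prod xs ≈ prod ys →
                       Σ (List A) λ zs → (zs ↭ ys) × Pointwise Associated xs zs

module Quot {c ℓ} (R : CommutativeRing c ℓ) (ufd : IsUFD R) where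
  open CommutativeRing R renaming (Carrier to A)
  open IsUFD ufd

  record Frac : Set (c ⊔ ℓ) where
    constructor frac
    field
      num    : A
      den    : A
      den≉0  : ¬ (den ≈ 0#)
  open Frac

  private
    *-≉0 : ∀ {a b} → ¬ (a ≈ 0#) → ¬ (b ≈ 0#) → ¬ (a * b ≈ 0#)
    *-≉0 a≉0 b≉0 ab≈0 with noZeroDivisors ab≈0
    ... | _⊎_.inj₁ p = a≉0 p
    ... | _⊎_.inj₂ q = b≉0 q

  _≃_ : Frac → Frac → Set ℓ
  x ≃ y = num x * den y ≈ num y * den x

  _⊕_ : Frac → Frac → Frac
  x ⊕ y = frac (num x * den y + num y * den x) (den x * den y)
               (*-≉0 (den≉0 x) (den≉0 y))

  _⊗_ : Frac → Frac → Frac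
  x ⊗ y = frac (num x * num y) (den x * den y) (*-≉0 (den≉0 x) (den≉0 y))

  ⊖_ : Frac → Frac
  ⊖ x = frac (- num x) (den x) (den≉0 x)

  ι : A → Frac
  ι a = frac a 1# 1≉0

  QRawRing : RawRing (c ⊔ ℓ) ℓ
  QRawRing = record
    { Carrier = Frac ; _≈_ = _≃_ ; _+_ = _⊕_ ; _*_ = _⊗_ ; -_ = ⊖_
    ; 0# = ι 0# ; 1# = ι 1# }

-- Dirichlet polynomials over a (raw) ring K: coefficient functions
-- a : ℕ → K, where a i is the coefficient of 1/i^s; index 0 carries
-- coefficient 0 (indices are positive integers), finite support.

module Dirichlet {c ℓ} (K : RawRing c ℓ) where
  open RawRing K renaming (Carrier to A)

  sum1 : ℕ → (ℕ → A) → A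
  sum1 zero    f = 0#
  sum1 (suc n) f = sum1 n f + f (suc n)

  _⋆_ : (ℕ → A) → (ℕ → A) → ℕ → A
  (b ⋆ c) i = sum1 i λ j → sum1 i λ k → term j k
    where
    term : ℕ → ℕ → A
    term j k with j ℕ.* k ℕP.≟ i
    ... | yes _ = b j * c k
    ... | no  _ = 0#

  record DirichletPoly : Set (c ⊔ ℓ) where
    constructor dpoly
    field
      coeff   : ℕ → A
      coeff0  : coeff 0 ≈ 0#
      finite  : ∃ λ N → ∀ i → N ℕ.< i → coeff i ≈ 0#

  IsConstant : (ℕ → A) → Set ℓ
  IsConstant b = ∀ i → i ≢ 1 → b i ≈ 0#

  IrreducibleOver : (ℕ → A) → Set (c ⊔ ℓ)
  IrreducibleOver f =
    ¬ (Σ DirichletPoly λ g → Σ DirichletPoly λ h →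
         ¬ IsConstant (DirichletPoly.coeff g) ×
         ¬ IsConstant (DirichletPoly.coeff h) ×
         (∀ i → f i ≈ (DirichletPoly.coeff g ⋆ DirichletPoly.coeff h) i))

module _ {c ℓ} {A : Set c} (_≈_ : A → A → Set ℓ) (0# : A) where
  open import Data.Nat.Divisibility using () renaming (_∣_ to _∣ℕ_)

  AlgebraicallyPrimitive : (ℕ → A) → Set ℓ
  AlgebraicallyPrimitive a = ∀ d → (∀ i → ¬ (a i ≈ 0#) → d ∣ℕ i) → d ≡ 1

module Submission where

-- Let v be the p-adic valuation of Q(R). That any two valuations are comparable rests on the
-- factorisation of elements into irreducibles and holds only under double negation, which
-- suffices because irreducibility is a negative statement.
--
-- Suppose f = g h with g, h nonconstant, and let j₀, k₀ be the least indices at which g and h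
-- attain their minimal valuations. By Gauss's lemma every coefficient of f has valuation at least
-- v(g_j₀ h_k₀), with equality at index j₀ k₀, where g_j₀ h_k₀ is the only term of that valuation.
-- In case (i) p divides every a_i but a_n, so j₀ k₀ = n and v(g_j₀ h_k₀) = 0. If m_g, m_h are the
-- least indices in the supports of g and h, then a_m = g_m_g h_m_h, and p² ∤ a_m forces one factor,
-- say g_m_g, to have minimal valuation, so that j₀ = m_g. Writing n_g, n_h for the greatest indices
-- of the supports, m_g k₀ = n = n_g n_h with m_g ≤ n_g and k₀ ≤ n_h gives m_g = n_g: g is a
-- monomial, its index divides every index of f, and primitivity makes g constant. Case (ii) is
-- the same argument with the order of the indices reversed.

open import Defs
open import Level using (Level)
open import Data.Nat.Base using (ℕ; _≤_; _<_)
open import Data.Sum.Base using (_⊎_)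
open import Data.Product.Base using (_×_)
open import Relation.Nullary using (¬_)
open import Algebra.Bundles using (CommutativeRing; RawRing)
open import Algebra.Definitions.RawSemiring using (Prime)

open import Data.Empty using (⊥)
open import Data.List.Relation.Unary.All using (All; []; _∷_)
open import Data.Nat.Base as ℕ using (zero; suc; NonZero; >-nonZero)
import Data.Nat.Properties as ℕ
open import Data.Nat.Divisibility using (m∣m*n; n∣m*n) renaming (_∣_ to _∣ℕ_; _∣?_ to _∣ℕ?_)
open import Data.Product.Base using (∃; _,_; proj₁; proj₂)
open import Data.Sum.Base using (inj₁; inj₂; [_,_]′)
open import Function.Base using (flip; _∘_; id)
open import Relation.Binary.Core using (Rel)
open import Relation.Binary.Definitions using (tri<; tri≈; tri>)
open import Relation.Binary.Structures using (IsStrictTotalOrder)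
import Relation.Binary.Construct.Flip.EqAndOrd as Flip
open import Relation.Binary.PropositionalEquality as ≡ using (_≡_; _≢_)
open import Relation.Nullary.Decidable using (Dec; yes; no; ¬¬-excluded-middle; decidable-stable)
open import Relation.Nullary.Negation using (contradiction)

private
  variable
    a : Level
    X Y : Set a

  _>>=_ : ¬ ¬ X → (X → ¬ ¬ Y) → ¬ ¬ Y
  (¬¬x >>= f) ¬y = ¬¬x λ x → f x ¬y

  return : X → ¬ ¬ X
  return = contradiction

  extend : ∀ {Q : ℕ → Set a} {n} → (∀ k → k < n → Q k) → Q n → ∀ k → k < suc n → Q k
  extend below at k k<1+n with ℕ.m<1+n⇒m<n∨m≡n k<1+n
  ... | inj₁ k<n    = below k k<n
  ... | inj₂ ≡.refl = at

-- Classical reasoning about finitely many indices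

¬¬-∀ : ∀ {P : ℕ → Set a} N → (∀ j → N < j → P j) → (∀ j → ¬ ¬ P j) → ¬ ¬ (∀ j → P j)
¬¬-∀ {P = P} N eventually ¬¬P = do
  below ← ¬¬-below (suc N)
  return λ j → [ (λ j≤N → below j (ℕ.s≤s j≤N)) , eventually j ]′ (ℕ.≤-<-connex j N)
  where
  ¬¬-below : ∀ n → ¬ ¬ (∀ j → j < n → P j)
  ¬¬-below zero    = return λ _ ()
  ¬¬-below (suc n) = do
    below ← ¬¬-below n
    at ← ¬¬P n
    return (extend below at)

module _ {r} {_⊏_ : Rel ℕ r} (⊏-isStrictTotalOrder : IsStrictTotalOrder _≡_ _⊏_) where
  open IsStrictTotalOrder ⊏-isStrictTotalOrder using (compare; irrefl) renaming (trans to ⊏-trans)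

  private
    Least : ∀ {q} → (ℕ → Set q) → ℕ → Set (r Level.⊔ q)
    Least P n = ∃ λ j → P j × ∀ k → k < n → k ⊏ j → ¬ P k

    ¬¬-least-below : ∀ {q} {P : ℕ → Set q} n → ¬ ¬ (Least P n ⊎ (∀ k → k < n → ¬ P k))
    ¬¬-least-below zero = return (inj₂ λ _ ())
    ¬¬-least-below {P = P} (suc n) = do
      found ← ¬¬-least-below n
      P? ← ¬¬-excluded-middle
      return (step found P?)
      where
      n-least : ∀ {j} → (∀ k → k < n → k ⊏ j → ¬ P k) → n ⊏ j → ∀ k → k < suc n → k ⊏ n → ¬ P k
      n-least min n⊏j = extend (λ k k<n k⊏n → min k k<n (⊏-trans k⊏n n⊏j)) (λ n⊏n _ → irrefl ≡.refl n⊏n)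

      step : Least P n ⊎ (∀ k → k < n → ¬ P k) → Dec (P n) →
             Least P (suc n) ⊎ (∀ k → k < suc n → ¬ P k)
      step (inj₂ none) (no ¬Pn) = inj₂ (extend none ¬Pn)
      step (inj₂ none) (yes Pn) = inj₁ (n , Pn , extend (λ k k<n _ → none k k<n) (λ n⊏n _ → irrefl ≡.refl n⊏n))
      step (inj₁ (j , Pj , min)) (no ¬Pn) = inj₁ (j , Pj , extend min λ _ → ¬Pn)
      step (inj₁ (j , Pj , min)) (yes Pn) with compare n j
      ... | tri< n⊏j _ _ = inj₁ (n , Pn , n-least min n⊏j)
      ... | tri≈ n⊏̸j _ _ = inj₁ (j , Pj , extend min λ n⊏j _ → n⊏̸j n⊏j)
      ... | tri> n⊏̸j _ _ = inj₁ (j , Pj , extend min λ n⊏j _ → n⊏̸j n⊏j)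

  ¬¬-least : ∀ {q} {P : ℕ → Set q} N {w} → (∀ j → P j → j ≤ N) → P w →
             ¬ ¬ (∃ λ j → P j × ∀ k → k ⊏ j → ¬ P k)
  ¬¬-least {P = P} N bounded Pw = do
    found ← ¬¬-least-below (suc N)
    return (least found)
    where
    least : Least P (suc N) ⊎ (∀ k → k < suc N → ¬ P k) → ∃ λ j → P j × ∀ k → k ⊏ j → ¬ P k
    least (inj₂ none)           = contradiction Pw (none _ (ℕ.s≤s (bounded _ Pw)))
    least (inj₁ (j , Pj , min)) = j , Pj , λ k k⊏j Pk → min k (ℕ.s≤s (bounded k Pk)) k⊏j Pk

-- Case (ii) of the theorem is case (i) read in the descending direction.
record Direction : Set₁ where
  infix 4 _⊏_
  field
    _⊏_                : Rel ℕ Level.zero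
    isStrictTotalOrder : IsStrictTotalOrder _≡_ _⊏_
    *-mono-⊒           : ∀ {j j′ k k′} → ¬ j ⊏ j′ → ¬ k ⊏ k′ → ¬ j ℕ.* k ⊏ j′ ℕ.* k′
    *-cancel-⊒         : ∀ {j j′ k k′} → ¬ j ⊏ j′ → ¬ k ⊏ k′ →
                         j ℕ.* k ≡ j′ ℕ.* k′ → 0 < j ℕ.* k → j ≡ j′ × k ≡ k′

  open IsStrictTotalOrder isStrictTotalOrder public using (compare) renaming (_<?_ to _⊏?_)

ascending : Direction
ascending = record
  { _⊏_                = _<_
  ; isStrictTotalOrder = ℕ.<-isStrictTotalOrder
  ; *-mono-⊒           = λ j≮j′ k≮k′ → ℕ.≤⇒≯ (ℕ.*-mono-≤ (ℕ.≮⇒≥ j≮j′) (ℕ.≮⇒≥ k≮k′))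
  ; *-cancel-⊒         = cancel
  }
  where
  cancel : ∀ {j j′ k k′} → ¬ j < j′ → ¬ k < k′ → j ℕ.* k ≡ j′ ℕ.* k′ → 0 < j ℕ.* k →
           j ≡ j′ × k ≡ k′
  cancel {j} {j′} {k} {k′} j≮j′ k≮k′ jk≡j′k′ 0<jk = ≡.sym j′≡j , ≡.sym k′≡k
    where
    instance
      _ : NonZero k
      _ = ℕ.m*n≢0⇒n≢0 j {{>-nonZero 0<jk}}
      _ : NonZero j′
      _ = ℕ.m*n≢0⇒m≢0 j′ {{>-nonZero (≡.subst (0 <_) jk≡j′k′ 0<jk)}}
    j′k≡jk : j′ ℕ.* k ≡ j ℕ.* k
    j′k≡jk = ℕ.≤-antisym (ℕ.*-monoˡ-≤ k (ℕ.≮⇒≥ j≮j′))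
               (≡.subst (ℕ._≤ j′ ℕ.* k) (≡.sym jk≡j′k′) (ℕ.*-monoʳ-≤ j′ (ℕ.≮⇒≥ k≮k′)))
    j′≡j : j′ ≡ j
    j′≡j = ℕ.*-cancelʳ-≡ j′ j k j′k≡jk
    k′≡k : k′ ≡ k
    k′≡k = ℕ.*-cancelˡ-≡ k′ k j′ (≡.trans (≡.sym jk≡j′k′) (≡.cong (ℕ._* k) (≡.sym j′≡j)))

reverse : Direction → Direction
reverse d = record
  { _⊏_                = flip _⊏_
  ; isStrictTotalOrder = Flip.isStrictTotalOrder isStrictTotalOrder
  ; *-mono-⊒           = *-mono-⊒
  ; *-cancel-⊒         = λ j′⊏̸j k′⊏̸k jk≡j′k′ 0<jk →
      let j′≡j , k′≡k = *-cancel-⊒ j′⊏̸j k′⊏̸k (≡.sym jk≡j′k′) (≡.subst (0 <_) jk≡j′k′ 0<jk)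
      in ≡.sym j′≡j , ≡.sym k′≡k
  }
  where open Direction d

descending : Direction
descending = reverse ascending

-- p-adic valuations in a unique factorisation domain

module PAdicValuation {c ℓ} (R : CommutativeRing c ℓ) (ufd : IsUFD R) {p : CommutativeRing.Carrier R}
                      (p-prime : Prime (RawRing.rawSemiring (CommutativeRing.rawRing R)) p) where

  open CommutativeRing R renaming (Carrier to A)
  open IsUFD ufd using (noZeroDivisors; factorization)
  open Prime p-prime
  open import Algebra.Definitions.RawSemiring (RawRing.rawSemiring (CommutativeRing.rawRing R))
    using (_^_; Irreducible)
  open import Algebra.Properties.Semiring.Divisibility semiring
  open import Algebra.Properties.CommutativeSemigroup.Divisibility *-commutativeSemigroup
    using (∙-cong-∣; x∣y⇒zx∣zy; x∣xy)
  open import Algebra.Properties.Semiring.Exp semiring using (^-homo-*)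
  open import Algebra.Properties.Ring ring using (x[y-z]≈xy-xz; [y-z]x≈yx-zx)
  open import Algebra.Properties.Group +-group using (//-rightDividesʳ; x∙y⁻¹≈ε⇒x≈y; x≈y⇒x∙y⁻¹≈ε)
  open import Algebra.Solver.Ring.NaturalCoefficients.Default commutativeSemiring
  open import Relation.Binary.Reasoning.Setoid setoid

  private
    variable
      r r′ s t t′ u x y z : A
      e f : ℕ

  ∣-+ : x ∣ y → x ∣ z → x ∣ y + z
  ∣-+ (q , qx≈y) (q′ , q′x≈z) = q + q′ , trans (distribʳ _ q q′) (+-cong qx≈y q′x≈z)

  ∣-cancelʳ-+ : x ∣ y + z → x ∣ z → x ∣ y
  ∣-cancelʳ-+ {x} {y} {z} (q , qx≈y+z) (q′ , q′x≈z) =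
    q - q′ , trans ([y-z]x≈yx-zx x q q′) (trans (+-cong qx≈y+z (-‿cong q′x≈z)) (//-rightDividesʳ z y))

  *-cancelˡ : ¬ z ≈ 0# → z * x ≈ z * y → x ≈ y
  *-cancelˡ {z} {x} {y} z≉0 zx≈zy with noZeroDivisors (trans (x[y-z]≈xy-xz z x y) (x≈y⇒x∙y⁻¹≈ε zx≈zy))
  ... | inj₁ z≈0   = contradiction z≈0 z≉0
  ... | inj₂ x-y≈0 = x∙y⁻¹≈ε⇒x≈y x y x-y≈0

  ∣-cancelˡ : ¬ z ≈ 0# → z * x ∣ z * y → x ∣ y
  ∣-cancelˡ {z} {x} {y} z≉0 (q , q[zx]≈zy) = q , *-cancelˡ z≉0 (begin
    z * (q * x)  ≈⟨ solve 3 (λ z q x → z :* (q :* x) := q :* (z :* x)) refl z q x ⟩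
    q * (z * x)  ≈⟨ q[zx]≈zy ⟩
    z * y        ∎)

  p∤-* : p ∤ s → p ∤ t → p ∤ s * t
  p∤-* p∤s p∤t p∣st = [ p∤s , p∤t ]′ (split-∣ p∣st)

  infix 4 _≼_ _≺_ _HasValuation_

  -- r ≼ t says v(r) ≤ v(t), i.e. r divides t in the localisation of R at p.
  _≼_ : A → A → Set (c Level.⊔ ℓ)
  r ≼ t = ∃ λ s → p ∤ s × r ∣ s * t

  _≺_ : A → A → Set (c Level.⊔ ℓ)
  r ≺ t = p * r ≼ t

  ∣⇒≼ : r ∣ t → r ≼ t
  ∣⇒≼ r∣t = 1# , p∤1 , ∣ʳ-respʳ-≈ (sym (*-identityˡ _)) r∣t

  ≼-refl : r ≼ r
  ≼-refl = ∣⇒≼ ∣ʳ-refl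

  1≼ : 1# ≼ t
  1≼ = ∣⇒≼ (ε∣ʳ _)

  ≼-0 : r ≼ 0#
  ≼-0 = ∣⇒≼ (_ ∣0)

  ≼-resp-≈ : r ≈ r′ → t ≈ t′ → r ≼ t → r′ ≼ t′
  ≼-resp-≈ r≈r′ t≈t′ (s , p∤s , r∣st) = s , p∤s , ∣ʳ-respˡ-≈ r≈r′ (∣ʳ-respʳ-≈ (*-congˡ t≈t′) r∣st)

  ≼-trans : r ≼ t → t ≼ u → r ≼ u
  ≼-trans {u = u} (s , p∤s , r∣st) (s′ , p∤s′ , t∣s′u) =
    s * s′ , p∤-* p∤s p∤s′ , ∣ʳ-trans r∣st (∣ʳ-respʳ-≈ (sym (*-assoc s s′ u)) (x∣y⇒zx∣zy s t∣s′u))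

  ≼-* : r ≼ t → r′ ≼ t′ → r * r′ ≼ t * t′
  ≼-* {t = t} {t′ = t′} (s , p∤s , r∣st) (s′ , p∤s′ , r′∣s′t′) =
    s * s′ , p∤-* p∤s p∤s′ , ∣ʳ-respʳ-≈ (interchange s t s′ t′) (∙-cong-∣ r∣st r′∣s′t′)
    where
    interchange : ∀ s t s′ t′ → (s * t) * (s′ * t′) ≈ (s * s′) * (t * t′)
    interchange = solve 4 (λ s t s′ t′ → (s :* t) :* (s′ :* t′) := (s :* s′) :* (t :* t′)) refl

  ≼-+ : r ≼ t → r ≼ u → r ≼ t + u
  ≼-+ {t = t} {u = u} (s , p∤s , r∣st) (s′ , p∤s′ , r∣s′u) =
    s * s′ , p∤-* p∤s p∤s′ , ∣ʳ-respʳ-≈ (factor s t s′ u) (∣-+ (x∣ʳy⇒x∣ʳzy s′ r∣st) (x∣ʳy⇒x∣ʳzy s r∣s′u))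
    where
    factor : ∀ s t s′ u → s′ * (s * t) + s * (s′ * u) ≈ (s * s′) * (t + u)
    factor = solve 4 (λ s t s′ u → s′ :* (s :* t) :+ s :* (s′ :* u) := (s :* s′) :* (t :+ u)) refl

  ≼-cancelʳ-+ : r ≼ t + u → r ≼ u → r ≼ t
  ≼-cancelʳ-+ {t = t} {u = u} (s , p∤s , r∣s[t+u]) (s′ , p∤s′ , r∣s′u) =
    s * s′ , p∤-* p∤s p∤s′ ,
    ∣-cancelʳ-+ (∣ʳ-respʳ-≈ (expand s t s′ u) (x∣ʳy⇒x∣ʳzy s′ r∣s[t+u])) (x∣ʳy⇒x∣ʳzy s r∣s′u)
    where
    expand : ∀ s t s′ u → s′ * (s * (t + u)) ≈ (s * s′) * t + s * (s′ * u)
    expand = solve 4 (λ s t s′ u → s′ :* (s :* (t :+ u)) := (s :* s′) :* t :+ s :* (s′ :* u)) refl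

  ≼-cancelˡ : ¬ z ≈ 0# → z * r ≼ z * t → r ≼ t
  ≼-cancelˡ {z} {t = t} z≉0 (s , p∤s , zr∣szt) = s , p∤s , ∣-cancelˡ z≉0 (∣ʳ-respʳ-≈ (swap s z t) zr∣szt)
    where
    swap : ∀ s z t → s * (z * t) ≈ z * (s * t)
    swap = solve 3 (λ s z t → s :* (z :* t) := z :* (s :* t)) refl

  0≼⇒≈0 : 0# ≼ t → t ≈ 0#
  0≼⇒≈0 (s , p∤s , 0∣st) with noZeroDivisors (0∣x⇒x≈0 0∣st)
  ... | inj₁ s≈0 = contradiction (∣ʳ-respʳ-≈ (sym s≈0) (p ∣0)) p∤s
  ... | inj₂ t≈0 = t≈0

  ≺-irrefl : ¬ r ≈ 0# → ¬ r ≺ r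
  ≺-irrefl {r} r≉0 pr≼r with ≼-cancelˡ r≉0 (≼-resp-≈ (*-comm p r) (sym (*-identityʳ r)) pr≼r)
  ... | s , p∤s , p∣s1 = p∤s (∣ʳ-respʳ-≈ (*-identityʳ s) p∣s1)

  p^k≼⇒p^k∣ : ∀ k → p ^ k ≼ t → p ^ k ∣ t
  p^k≼⇒p^k∣ {t} zero    _ = ε∣ʳ t
  p^k≼⇒p^k∣ {t} (suc k) (s , p∤s , p^1+k∣st) with split-∣ (∣ʳ-trans (x∣xy p (p ^ k)) p^1+k∣st)
  ... | inj₁ p∣s        = contradiction p∣s p∤s
  ... | inj₂ (q , qp≈t) = ∣ʳ-respʳ-≈ (trans (*-comm p q) qp≈t) (x∣y⇒zx∣zy p p^k∣q)
    where
    p^k∣q : p ^ k ∣ q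
    p^k∣q = p^k≼⇒p^k∣ k (s , p∤s , ∣-cancelˡ p≉0 (∣ʳ-respʳ-≈ (begin
      s * t        ≈⟨ *-congˡ (sym qp≈t) ⟩
      s * (q * p)  ≈⟨ solve 3 (λ s q p → s :* (q :* p) := p :* (s :* q)) refl s q p ⟩
      p * (s * q)  ∎) p^1+k∣st))

  _HasValuation_ : A → ℕ → Set (c Level.⊔ ℓ)
  r HasValuation e = ∃ λ u → p ∤ u × r ≈ p ^ e * u

  valuation-resp-≈ : r ≈ t → r HasValuation e → t HasValuation e
  valuation-resp-≈ r≈t (u , p∤u , r≈p^eu) = u , p∤u , trans (sym r≈t) r≈p^eu

  valuation-* : r HasValuation e → t HasValuation f → r * t HasValuation e ℕ.+ f
  valuation-* {r = r} {e = e} {t = t} {f = f} (u , p∤u , r≈p^eu) (w , p∤w , t≈p^fw) =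
    u * w , p∤-* p∤u p∤w , (begin
      r * t                      ≈⟨ *-cong r≈p^eu t≈p^fw ⟩
      (p ^ e * u) * (p ^ f * w)  ≈⟨ solve 4 (λ E u F w → (E :* u) :* (F :* w) := (E :* F) :* (u :* w))
                                             refl (p ^ e) u (p ^ f) w ⟩
      (p ^ e * p ^ f) * (u * w)  ≈⟨ *-congʳ (sym (^-homo-* p e f)) ⟩
      p ^ (e ℕ.+ f) * (u * w)    ∎)

  p*-valuation : t HasValuation f → p * t HasValuation suc f
  p*-valuation {f = f} (u , p∤u , t≈p^fu) = u , p∤u , trans (*-congˡ t≈p^fu) (sym (*-assoc p (p ^ f) u))

  unit-valuation : u ∣ 1# → u HasValuation 0
  unit-valuation {u} u∣1 = u , (λ p∣u → p∤1 (∣ʳ-trans p∣u u∣1)) , sym (*-identityˡ u)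

  irreducible-valuation : Irreducible x → ¬ ¬ ∃ (x HasValuation_)
  irreducible-valuation {x} x-irreducible = do
    p∣x? ← ¬¬-excluded-middle
    return (valuation p∣x?)
    where
    open Irreducible x-irreducible using (split-∣1)
    valuation : Dec (p ∣ x) → ∃ (x HasValuation_)
    valuation (no p∤x) = 0 , x , p∤x , sym (*-identityˡ x)
    valuation (yes (q , qp≈x)) with split-∣1 (sym qp≈x)
    ... | inj₂ p∣1 = contradiction p∣1 p∤1
    ... | inj₁ q∣1 = 1 , q , proj₁ (proj₂ (unit-valuation q∣1)) , (begin
      x          ≈⟨ sym qp≈x ⟩
      q * p      ≈⟨ *-comm q p ⟩
      p * q      ≈⟨ *-congʳ (sym (*-identityʳ p)) ⟩
      p ^ 1 * q  ∎)

  product-valuation : ∀ {xs} → All Irreducible xs → ¬ ¬ ∃ (prod R xs HasValuation_)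
  product-valuation []                     = return (0 , unit-valuation ∣ʳ-refl)
  product-valuation (x-irreducible ∷ irrs) = do
    e , x-valuation ← irreducible-valuation x-irreducible
    f , xs-valuation ← product-valuation irrs
    return (e ℕ.+ f , valuation-* {e = e} {f = f} x-valuation xs-valuation)

  ¬¬-valuation : ¬ r ≈ 0# → ¬ ¬ ∃ (r HasValuation_)
  ¬¬-valuation {r} r≉0 = do
    unit? ← ¬¬-excluded-middle
    valuation unit?
    where
    valuation : Dec (r ∣ 1#) → ¬ ¬ ∃ (r HasValuation_)
    valuation (yes r∣1) = return (0 , unit-valuation r∣1)
    valuation (no r∤1)  = do
      let xs , irrs , prod≈r = factorization r r≉0 r∤1
      e , prod-valuation ← product-valuation irrs
      return (e , valuation-resp-≈ {e = e} prod≈r prod-valuation)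

  valuation-≤⇒≼ : r HasValuation e → t HasValuation f → e ℕ.≤ f → r ≼ t
  valuation-≤⇒≼ {r = r} {e = e} {t = t} {f = f} (u , p∤u , r≈p^eu) (w , _ , t≈p^fw) e≤f =
    u , p∤u , (p ^ (f ℕ.∸ e) * w , (begin
      (p ^ (f ℕ.∸ e) * w) * r            ≈⟨ *-congˡ r≈p^eu ⟩
      (p ^ (f ℕ.∸ e) * w) * (p ^ e * u)  ≈⟨ solve 4 (λ D w E u → (D :* w) :* (E :* u) := u :* ((E :* D) :* w))
                                                     refl (p ^ (f ℕ.∸ e)) w (p ^ e) u ⟩
      u * ((p ^ e * p ^ (f ℕ.∸ e)) * w)  ≈⟨ *-congˡ (*-congʳ (sym (^-homo-* p e (f ℕ.∸ e)))) ⟩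
      u * (p ^ (e ℕ.+ (f ℕ.∸ e)) * w)    ≈⟨ *-congˡ (*-congʳ (reflexive (≡.cong (p ^_) (ℕ.m+[n∸m]≡n e≤f)))) ⟩
      u * (p ^ f * w)                    ≈⟨ *-congˡ (sym t≈p^fw) ⟩
      u * t                              ∎))

  ≼-total : ∀ r t → ¬ ¬ (r ≼ t ⊎ t ≺ r)
  ≼-total r t = do
    r≈0? ← ¬¬-excluded-middle
    t≈0? ← ¬¬-excluded-middle
    compare r≈0? t≈0?
    where
    compare : Dec (r ≈ 0#) → Dec (t ≈ 0#) → ¬ ¬ (r ≼ t ⊎ t ≺ r)
    compare (yes r≈0) _         = return (inj₂ (≼-resp-≈ refl (sym r≈0) ≼-0))
    compare (no _)    (yes t≈0) = return (inj₁ (≼-resp-≈ refl (sym t≈0) ≼-0))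
    compare (no r≉0)  (no t≉0)  = do
      e , r-valuation ← ¬¬-valuation r≉0
      f , t-valuation ← ¬¬-valuation t≉0
      return ([ (λ e≤f → inj₁ (valuation-≤⇒≼ r-valuation t-valuation e≤f))
              , (λ f<e → inj₂ (valuation-≤⇒≼ (p*-valuation {f = f} t-valuation) r-valuation f<e))
              ]′ (ℕ.≤-<-connex e f))

-- The p-adic valuation on the quotient field

module QuotientValuation {c ℓ} (R : CommutativeRing c ℓ) (ufd : IsUFD R) {p : CommutativeRing.Carrier R}
                         (p-prime : Prime (RawRing.rawSemiring (CommutativeRing.rawRing R)) p) where

  open CommutativeRing R renaming (Carrier to A)
  open IsUFD ufd using (noZeroDivisors)
  open Quot R ufd
  open Frac
  open Dirichlet QRawRing using (sum1; _⋆_; IsConstant; DirichletPoly)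
  open import Algebra.Properties.Semiring.Divisibility semiring using (_∣_; _,_; ∣ʳ-respˡ-≈; ∣ʳ-respʳ-≈; _∣0)
  open import Algebra.Solver.Ring.NaturalCoefficients.Default commutativeSemiring
  private module V = PAdicValuation R ufd p-prime

  private
    variable
      r t : A
      x x′ y y′ z : Frac

  IsZero : Frac → Set ℓ
  IsZero x = x ≃ ι 0#

  IsZero⇒num≈0 : IsZero x → num x ≈ 0#
  IsZero⇒num≈0 {x} x≃0 = trans (sym (*-identityʳ (num x))) (trans x≃0 (zeroˡ (den x)))

  num≈0⇒IsZero : num x ≈ 0# → IsZero x
  num≈0⇒IsZero {x} nx≈0 = trans (*-identityʳ (num x)) (trans nx≈0 (sym (zeroˡ (den x))))

  ⊗-zeroˡ : IsZero x → IsZero (x ⊗ y)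
  ⊗-zeroˡ {x} {y} x≃0 = num≈0⇒IsZero {x ⊗ y} (trans (*-congʳ (IsZero⇒num≈0 {x} x≃0)) (zeroˡ (num y)))

  ⊗-zeroʳ : IsZero y → IsZero (x ⊗ y)
  ⊗-zeroʳ {y} {x} y≃0 = num≈0⇒IsZero {x ⊗ y} (trans (*-congˡ (IsZero⇒num≈0 {y} y≃0)) (zeroʳ (num x)))

  ⊗-nonzero : ¬ IsZero x → ¬ IsZero y → ¬ IsZero (x ⊗ y)
  ⊗-nonzero {x} {y} x≄0 y≄0 xy≃0 with noZeroDivisors (IsZero⇒num≈0 {x ⊗ y} xy≃0)
  ... | inj₁ nx≈0 = x≄0 (num≈0⇒IsZero {x} nx≈0)
  ... | inj₂ ny≈0 = y≄0 (num≈0⇒IsZero {y} ny≈0)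

  infix 4 _≼_ _≺_
  infixr 8 p⊙_

  record _≼_ (x y : Frac) : Set (c Level.⊔ ℓ) where
    constructor cross
    field uncross : num x * den y V.≼ num y * den x

  p⊙_ : Frac → Frac
  p⊙ x = ι p ⊗ x

  record _≺_ (x y : Frac) : Set (c Level.⊔ ℓ) where
    constructor strict
    field unstrict : p⊙ x ≼ y

  private
    ≼-*ʳ : ∀ z → r V.≼ t → r * z V.≼ t * z
    ≼-*ʳ z r≼t = V.≼-* r≼t V.≼-refl

  ≃⇒≼ : x ≃ y → x ≼ y
  ≃⇒≼ x≃y = cross (V.≼-resp-≈ refl x≃y V.≼-refl)

  ≼-refl : x ≼ x
  ≼-refl = cross V.≼-refl

  ≼-trans : x ≼ y → y ≼ z → x ≼ z
  ≼-trans {x} {y} {z} (cross x≼y) (cross y≼z) = cross (V.≼-cancelˡ (den≉0 y)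
    (V.≼-resp-≈ (rearrange (num x) (den y) (den z)) (rearrange (num z) (den y) (den x))
      (V.≼-trans (V.≼-resp-≈ refl (rearrange′ (num y) (den x) (den z)) (≼-*ʳ (den z) x≼y))
                 (≼-*ʳ (den x) y≼z))))
    where
    rearrange : ∀ a b d → (a * b) * d ≈ b * (a * d)
    rearrange = solve 3 (λ a b d → (a :* b) :* d := b :* (a :* d)) refl
    rearrange′ : ∀ a b d → (a * b) * d ≈ (a * d) * b
    rearrange′ = solve 3 (λ a b d → (a :* b) :* d := (a :* d) :* b) refl

  ≼-respʳ-≃ : y ≃ z → x ≼ y → x ≼ z
  ≼-respʳ-≃ y≃z x≼y = ≼-trans x≼y (≃⇒≼ y≃z)

  ≼-⊗ : x ≼ y → x′ ≼ y′ → x ⊗ x′ ≼ y ⊗ y′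
  ≼-⊗ {x} {y} {x′} {y′} (cross x≼y) (cross x′≼y′) = cross
    (V.≼-resp-≈ (interchange (num x) (den y) (num x′) (den y′)) (interchange (num y) (den x) (num y′) (den x′))
                (V.≼-* x≼y x′≼y′))
    where
    interchange : ∀ a b a′ b′ → (a * b) * (a′ * b′) ≈ (a * a′) * (b * b′)
    interchange = solve 4 (λ a b a′ b′ → (a :* b) :* (a′ :* b′) := (a :* a′) :* (b :* b′)) refl

  ≼-⊕ : x ≼ y → x ≼ z → x ≼ y ⊕ z
  ≼-⊕ {x} {y} {z} (cross x≼y) (cross x≼z) = cross
    (V.≼-resp-≈ (assoc (num x) (den y) (den z)) (collect (num y) (den z) (den x) (num z) (den y))
      (V.≼-+ (≼-*ʳ (den z) x≼y) (V.≼-resp-≈ (swap (num x) (den z) (den y)) refl (≼-*ʳ (den y) x≼z))))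
    where
    assoc : ∀ a b d → (a * b) * d ≈ a * (b * d)
    assoc = solve 3 (λ a b d → (a :* b) :* d := a :* (b :* d)) refl
    swap : ∀ a d b → (a * d) * b ≈ (a * b) * d
    swap = solve 3 (λ a d b → (a :* d) :* b := (a :* b) :* d) refl
    collect : ∀ b d e f g → (b * e) * d + (f * e) * g ≈ (b * d + f * g) * e
    collect = solve 5 (λ b d e f g → (b :* e) :* d :+ (f :* e) :* g := (b :* d :+ f :* g) :* e) refl

  ≼-cancelʳ-⊕ : x ≼ y ⊕ z → x ≼ z → x ≼ y
  ≼-cancelʳ-⊕ {x} {y} {z} (cross x≼y⊕z) (cross x≼z) = cross (V.≼-cancelˡ (den≉0 z)
    (V.≼-resp-≈ (rotate (num x) (den y) (den z)) (shuffle (num y) (den z) (den x))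
      (V.≼-cancelʳ-+ (V.≼-resp-≈ refl (distribʳ (den x) (num y * den z) (num z * den y)) x≼y⊕z)
                     (V.≼-resp-≈ (pull (num x) (den z) (den y)) (swap (num z) (den x) (den y))
                                 (≼-*ʳ (den y) x≼z)))))
    where
    rotate : ∀ a b d → a * (b * d) ≈ d * (a * b)
    rotate = solve 3 (λ a b d → a :* (b :* d) := d :* (a :* b)) refl
    shuffle : ∀ b d e → (b * d) * e ≈ d * (b * e)
    shuffle = solve 3 (λ b d e → (b :* d) :* e := d :* (b :* e)) refl
    pull : ∀ a d b → (a * d) * b ≈ a * (b * d)
    pull = solve 3 (λ a d b → (a :* d) :* b := a :* (b :* d)) refl
    swap : ∀ f e b → (f * e) * b ≈ (f * b) * e
    swap = solve 3 (λ f e b → (f :* e) :* b := (f :* b) :* e) refl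

  ⊕-comm : (y ⊕ z) ≃ (z ⊕ y)
  ⊕-comm {y} {z} =
    solve 4 (λ a b d e → (a :* e :+ d :* b) :* (e :* b) := (d :* b :+ a :* e) :* (b :* e)) refl
      (num y) (den y) (num z) (den z)

  ≼-zero : IsZero y → x ≼ y
  ≼-zero {y} {x} y≃0 =
    cross (V.≼-resp-≈ refl (sym (trans (*-congʳ (IsZero⇒num≈0 {y} y≃0)) (zeroˡ (den x)))) V.≼-0)

  zero-≼ : IsZero x → x ≼ y → IsZero y
  zero-≼ {x} {y} x≃0 (cross x≼y)
    with noZeroDivisors (V.0≼⇒≈0 (V.≼-resp-≈ (trans (*-congʳ (IsZero⇒num≈0 {x} x≃0)) (zeroˡ (den y))) refl x≼y))
  ... | inj₁ ny≈0 = num≈0⇒IsZero {y} ny≈0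
  ... | inj₂ dx≈0 = contradiction dx≈0 (den≉0 x)

  ≼-p⊙ : x ≼ p⊙ x
  ≼-p⊙ {x} =
    cross (V.∣⇒≼ (p , solve 3 (λ p a b → p :* (a :* (con 1 :* b)) := (p :* a) :* b) refl p (num x) (den x)))

  p⊙-⊗ˡ : (p⊙ (x ⊗ y)) ≃ ((p⊙ x) ⊗ y)
  p⊙-⊗ˡ {x} {y} =
    solve 5 (λ p a b d e → (p :* (a :* d)) :* ((con 1 :* b) :* e) := ((p :* a) :* d) :* (con 1 :* (b :* e))) refl
      p (num x) (den x) (num y) (den y)

  p⊙-⊗ʳ : (p⊙ (x ⊗ y)) ≃ (x ⊗ (p⊙ y))
  p⊙-⊗ʳ {x} {y} =
    solve 5 (λ p a b d e → (p :* (a :* d)) :* (b :* (con 1 :* e)) := (a :* (p :* d)) :* (con 1 :* (b :* e))) refl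
      p (num x) (den x) (num y) (den y)

  p⊙-mono : x ≼ y → p⊙ x ≼ p⊙ y
  p⊙-mono = ≼-⊗ (≼-refl {x = ι p})

  ≺⇒≼ : x ≺ y → x ≼ y
  ≺⇒≼ (strict p⊙x≼y) = ≼-trans ≼-p⊙ p⊙x≼y

  ≺-≼-trans : x ≺ y → y ≼ z → x ≺ z
  ≺-≼-trans (strict p⊙x≼y) y≼z = strict (≼-trans p⊙x≼y y≼z)

  ≼-≺-trans : x ≼ y → y ≺ z → x ≺ z
  ≼-≺-trans x≼y (strict p⊙y≼z) = strict (≼-trans (p⊙-mono x≼y) p⊙y≼z)

  ≺-⊗ˡ : x ≺ y → x′ ≼ y′ → x ⊗ x′ ≺ y ⊗ y′
  ≺-⊗ˡ {x} {x′ = x′} (strict p⊙x≼y) x′≼y′ = strict (≼-trans (≃⇒≼ (p⊙-⊗ˡ {x} {x′})) (≼-⊗ p⊙x≼y x′≼y′))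

  ≺-⊗ʳ : x ≼ y → x′ ≺ y′ → x ⊗ x′ ≺ y ⊗ y′
  ≺-⊗ʳ {x} {x′ = x′} x≼y (strict p⊙x′≼y′) = strict (≼-trans (≃⇒≼ (p⊙-⊗ʳ {x} {x′})) (≼-⊗ x≼y p⊙x′≼y′))

  ≺-zero : IsZero y → x ≺ y
  ≺-zero y≃0 = strict (≼-zero y≃0)

  ≺-irrefl : ¬ IsZero x → ¬ x ≺ x
  ≺-irrefl {x} x≄0 (strict (cross p⊙x≼x)) =
    V.≺-irrefl nxdx≉0 (V.≼-resp-≈ (*-assoc p (num x) (den x)) (*-congˡ (*-identityˡ (den x))) p⊙x≼x)
    where
    nxdx≉0 : ¬ num x * den x ≈ 0#
    nxdx≉0 nxdx≈0 with noZeroDivisors nxdx≈0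
    ... | inj₁ nx≈0 = x≄0 (num≈0⇒IsZero {x} nx≈0)
    ... | inj₂ dx≈0 = den≉0 x dx≈0

  ≼-total : ∀ x y → ¬ ¬ (x ≼ y ⊎ y ≺ x)
  ≼-total x y = do
    comparison ← V.≼-total (num x * den y) (num y * den x)
    return ([ inj₁ ∘ cross , inj₂ ∘ strict ∘ cross ∘ V.≼-resp-≈ p[yx]≈[py]x x1y≈x[1y] ]′ comparison)
    where
    p[yx]≈[py]x : p * (num y * den x) ≈ (p * num y) * den x
    p[yx]≈[py]x = sym (*-assoc p (num y) (den x))
    x1y≈x[1y] : num x * den y ≈ num x * (1# * den y)
    x1y≈x[1y] = *-congˡ (sym (*-identityˡ (den y)))

  ¬≺⇒¬¬≽ : ¬ x ≺ y → ¬ ¬ (y ≼ x)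
  ¬≺⇒¬¬≽ {x} {y} x⊀y = do
    comparison ← ≼-total y x
    return ([ id , (λ x≺y → contradiction x≺y x⊀y) ]′ comparison)

  ι-mono : r V.≼ t → ι r ≼ ι t
  ι-mono r≼t = cross (V.≼-resp-≈ (sym (*-identityʳ _)) (sym (*-identityʳ _)) r≼t)

  ι-reflects-≼ : ι r ≼ ι t → r V.≼ t
  ι-reflects-≼ (cross r1≼t1) = V.≼-resp-≈ (*-identityʳ _) (*-identityʳ _) r1≼t1

  ι-zero : IsZero (ι r) → r ≈ 0#
  ι-zero {r} r≃0 = IsZero⇒num≈0 {ι r} r≃0

  p⊙ι : (p⊙ ι r) ≃ ι (p * r)
  p⊙ι = *-congˡ (sym (*-identityʳ 1#))

  ι1≼ι : ι 1# ≼ ι t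
  ι1≼ι = ι-mono V.1≼

  p∣⇒ι1≺ι : p ∣ t → ι 1# ≺ ι t
  p∣⇒ι1≺ι p∣t = strict (≼-trans (≃⇒≼ p⊙ι) (ι-mono (V.≼-resp-≈ (sym (*-identityʳ p)) refl (V.∣⇒≼ p∣t))))

  ι1≺ι⇒p∣ : ι 1# ≺ ι t → p ∣ t
  ι1≺ι⇒p∣ (strict p⊙1≼t) =
    ∣ʳ-respˡ-≈ (*-identityʳ p) (V.p^k≼⇒p^k∣ 1 (ι-reflects-≼ (≼-trans (≃⇒≼ (sym p⊙ι)) p⊙1≼t)))

  ι1≺≺ι⇒p²∣ : ι 1# ≺ y → y ≺ ι t → p * p ∣ t
  ι1≺≺ι⇒p²∣ (strict p⊙1≼y) (strict p⊙y≼t) =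
    ∣ʳ-respˡ-≈ (*-congˡ (*-identityʳ p))
      (V.p^k≼⇒p^k∣ 2 (ι-reflects-≼ (≼-trans (≃⇒≼ (sym p⊙p⊙1≃p²)) (≼-trans (p⊙-mono p⊙1≼y) p⊙y≼t))))
    where
    p⊙p⊙1≃p² : (p⊙ p⊙ ι 1#) ≃ ι (p * (p * 1#))
    p⊙p⊙1≃p² = solve 1 (λ p → (p :* (p :* con 1)) :* con 1 := (p :* (p :* con 1)) :* (con 1 :* (con 1 :* con 1)))
                 refl p

  sum-≼ : ∀ n {F} → (∀ j → j ≤ n → x ≼ F j) → x ≼ sum1 n F
  sum-≼ zero    _   = ≼-zero refl
  sum-≼ (suc n) x≼F = ≼-⊕ (sum-≼ n λ j j≤n → x≼F j (ℕ.m≤n⇒m≤1+n j≤n)) (x≼F (suc n) ℕ.≤-refl)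

  sum-dominant : ∀ n {F j*} → 0 < j* → j* ≤ n → ¬ x ≼ F j* → (∀ j → j ≢ j* → x ≼ F j) → ¬ x ≼ sum1 n F
  sum-dominant zero    0<j* j*≤0 = contradiction (ℕ.<-≤-trans 0<j* j*≤0) λ ()
  sum-dominant (suc n) {F} 0<j* j*≤1+n x⋠Fj* x≼F x≼ΣF with ℕ.m≤n⇒m<n∨m≡n j*≤1+n
  ... | inj₁ j*<1+n = sum-dominant n 0<j* (ℕ.≤-pred j*<1+n) x⋠Fj* x≼F
                        (≼-cancelʳ-⊕ x≼ΣF (x≼F (suc n) λ 1+n≡j* → ℕ.<-irrefl (≡.sym 1+n≡j*) j*<1+n))
  ... | inj₂ ≡.refl = x⋠Fj* (≼-cancelʳ-⊕ (≼-respʳ-≃ (⊕-comm {sum1 n F} {F (suc n)}) x≼ΣF)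
                        (sum-≼ n λ j j≤n → x≼F j λ j≡1+n → ℕ.<-irrefl j≡1+n (ℕ.s≤s j≤n)))

  -- The summand of _⋆_ is local to its definition: the signatures of divisor and non-divisor
  -- leave it as a metavariable, which the definition of ⋆-as-sum solves by unification.
  module _ (g h : ℕ → Frac) (i : ℕ) where
    private
      divisor : ∀ j k → j ℕ.* k ≡ i → _ ≡ g j ⊗ h k
      non-divisor : ∀ j k → j ℕ.* k ≢ i → _ ≡ ι 0#

    ⋆-as-sum : ∃ λ (T : ℕ → ℕ → Frac) →
               (g ⋆ h) i ≡ sum1 i (λ j → sum1 i (T j)) ×
               (∀ j k → j ℕ.* k ≡ i → T j k ≡ g j ⊗ h k) × (∀ j k → j ℕ.* k ≢ i → T j k ≡ ι 0#)
    ⋆-as-sum = _ , ≡.refl , divisor , non-divisor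

    divisor j k jk≡i with j ℕ.* k ℕ.≟ i
    ... | yes _   = ≡.refl
    ... | no jk≢i = contradiction jk≡i jk≢i

    non-divisor j k jk≢i with j ℕ.* k ℕ.≟ i
    ... | yes jk≡i = contradiction jk≡i jk≢i
    ... | no _     = ≡.refl

  ⋆-≼ : ∀ {g h i} → (∀ j k → j ℕ.* k ≡ i → x ≼ g j ⊗ h k) → x ≼ (g ⋆ h) i
  ⋆-≼ {x} {g} {h} {i} x≼gh with ⋆-as-sum g h i
  ... | T , ⋆≡ΣΣT , divisor , non-divisor =
    ≡.subst (x ≼_) (≡.sym ⋆≡ΣΣT) (sum-≼ i λ j _ → sum-≼ i λ k _ → x≼T j k)
    where
    x≼T : ∀ j k → x ≼ T j k
    x≼T j k with j ℕ.* k ℕ.≟ i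
    ... | yes jk≡i = ≡.subst (x ≼_) (≡.sym (divisor j k jk≡i)) (x≼gh j k jk≡i)
    ... | no jk≢i  = ≡.subst (x ≼_) (≡.sym (non-divisor j k jk≢i)) (≼-zero refl)

  ⋆-dominant : ∀ {g h j* k*} → 0 < j* → 0 < k* → ¬ x ≼ g j* ⊗ h k* →
               (∀ j k → j ℕ.* k ≡ j* ℕ.* k* → ¬ (j ≡ j* × k ≡ k*) → x ≼ g j ⊗ h k) →
               ¬ x ≼ (g ⋆ h) (j* ℕ.* k*)
  ⋆-dominant {x} {g} {h} {j*} {k*} 0<j* 0<k* x⋠gh* x≼gh with ⋆-as-sum g h (j* ℕ.* k*)
  ... | T , ⋆≡ΣΣT , divisor , non-divisor =
    ≡.subst (λ y → ¬ x ≼ y) (≡.sym ⋆≡ΣΣT)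
      (sum-dominant i 0<j* (ℕ.m≤m*n j* k* {{>-nonZero 0<k*}})
        (sum-dominant i 0<k* (ℕ.m≤n*m k* j* {{>-nonZero 0<j*}})
          (≡.subst (λ y → ¬ x ≼ y) (≡.sym (divisor j* k* ≡.refl)) x⋠gh*)
          λ k k≢k* → x≼T j* k λ (_ , k≡k*) → k≢k* k≡k*)
        λ j j≢j* → sum-≼ i λ k _ → x≼T j k λ (j≡j* , _) → j≢j* j≡j*)
    where
    i : ℕ
    i = j* ℕ.* k*
    x≼T : ∀ j k → ¬ (j ≡ j* × k ≡ k*) → x ≼ T j k
    x≼T j k other with j ℕ.* k ℕ.≟ i
    ... | yes jk≡i = ≡.subst (x ≼_) (≡.sym (divisor j k jk≡i)) (x≼gh j k jk≡i other)
    ... | no jk≢i  = ≡.subst (x ≼_) (≡.sym (non-divisor j k jk≢i)) (≼-zero refl)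

  record FirstNonzero (d : Direction) (g : ℕ → Frac) : Set (c Level.⊔ ℓ) where
    open Direction d
    field
      index   : ℕ
      nonzero : ¬ IsZero (g index)
      before  : ∀ j → j ⊏ index → IsZero (g j)

  record FirstMinimal (d : Direction) (g : ℕ → Frac) : Set (c Level.⊔ ℓ) where
    open Direction d
    field
      index   : ℕ
      nonzero : ¬ IsZero (g index)
      minimal : ∀ j → g index ≼ g j
      before  : ∀ j → j ⊏ index → g index ≺ g j

  record Shape (d : Direction) (g : ℕ → Frac) : Set (c Level.⊔ ℓ) where
    field
      first : FirstNonzero d g
      last  : FirstNonzero (reverse d) g
      lead  : FirstMinimal d g

  index-positive : ∀ {g : ℕ → Frac} {j} → IsZero (g 0) → ¬ IsZero (g j) → 0 < j
  index-positive {j = zero}  g0≃0 g0≄0 = contradiction g0≃0 g0≄0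
  index-positive {j = suc _} _    _    = ℕ.s≤s ℕ.z≤n

  module _ {d : Direction} {g : ℕ → Frac} (F : FirstNonzero d g) where
    open Direction d
    open FirstNonzero F

    index-⊏ : ∀ {j} → ¬ IsZero (g j) → j ≢ index → index ⊏ j
    index-⊏ {j} g≄0 j≢index with compare j index
    ... | tri< j⊏index _ _ = contradiction (before j j⊏index) g≄0
    ... | tri≈ _ j≡index _ = contradiction j≡index j≢index
    ... | tri> _ _ index⊏j = index⊏j

    single-index : (L : FirstNonzero (reverse d) g) → FirstNonzero.index L ≡ index →
                   ∀ j → j ≢ index → IsZero (g j)
    single-index L last≡index j j≢index with compare j index
    ... | tri< j⊏index _ _ = before j j⊏index
    ... | tri≈ _ j≡index _ = contradiction j≡index j≢index
    ... | tri> _ _ index⊏j = FirstNonzero.before L j (≡.subst (_⊏ j) (≡.sym last≡index) index⊏j)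

  module _ (G : DirichletPoly) (nonconstant : ¬ IsConstant (DirichletPoly.coeff G)) where
    private
      g : ℕ → Frac
      g = DirichletPoly.coeff G
      N : ℕ
      N = proj₁ (DirichletPoly.finite G)
      beyond : ∀ j → N < j → IsZero (g j)
      beyond = proj₂ (DirichletPoly.finite G)
      nonzero⇒≤ : ∀ {j} → ¬ IsZero (g j) → j ≤ N
      nonzero⇒≤ {j} g≄0 = ℕ.≮⇒≥ λ N<j → g≄0 (beyond j N<j)

    ¬¬-decide-zero : ¬ ¬ (∀ j → Dec (IsZero (g j)))
    ¬¬-decide-zero = ¬¬-∀ N (λ j N<j → yes (beyond j N<j)) (λ _ → ¬¬-excluded-middle)

    ¬¬-nonzero : ¬ ¬ (∃ λ j → ¬ IsZero (g j))
    ¬¬-nonzero ¬nonzero = ¬¬-decide-zero λ zero? →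
      nonconstant λ i _ → decidable-stable (zero? i) λ g≄0 → ¬nonzero (i , g≄0)

    ¬¬-minimal : ¬ ¬ (∃ λ j → ∀ k → g j ≼ g k)
    ¬¬-minimal = do
      j , min ← ¬¬-minimal-below (suc N)
      return (j , λ k → [ (λ k≤N → min k (ℕ.s≤s k≤N)) , (λ N<k → ≼-zero (beyond k N<k)) ]′ (ℕ.≤-<-connex k N))
      where
      ¬¬-minimal-below : ∀ n → ¬ ¬ (∃ λ j → ∀ k → k < n → g j ≼ g k)
      ¬¬-minimal-below zero    = return (0 , λ _ ())
      ¬¬-minimal-below (suc n) = do
        j , min ← ¬¬-minimal-below n
        comparison ← ≼-total (g j) (g n)
        return ([ (λ gj≼gn → j , extend min gj≼gn)
                , (λ gn≺gj → n , extend (λ k k<n → ≼-trans (≺⇒≼ gn≺gj) (min k k<n)) ≼-refl)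
                ]′ comparison)

    ¬¬-firstNonzero : ∀ d → ¬ ¬ FirstNonzero d g
    ¬¬-firstNonzero d = do
      zero? ← ¬¬-decide-zero
      w , gw≄0 ← ¬¬-nonzero
      j , gj≄0 , before ← ¬¬-least isStrictTotalOrder N (λ _ → nonzero⇒≤) gw≄0
      return record { index = j ; nonzero = gj≄0 ; before = λ k k⊏j → decidable-stable (zero? k) (before k k⊏j) }
      where open Direction d

    ¬¬-firstMinimal : ∀ d → ¬ ¬ FirstMinimal d g
    ¬¬-firstMinimal d = do
      w , gw≄0 ← ¬¬-nonzero
      _ , min ← ¬¬-minimal
      j , min-j , before ← ¬¬-least isStrictTotalOrder N (λ j min-j → nonzero⇒≤ (minimal-nonzero gw≄0 min-j)) min
      strictly-before ← ¬¬-∀ N (λ k N<k _ → ≺-zero (beyond k N<k)) (λ k → strictly min-j (before k))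
      return record { index = j ; nonzero = minimal-nonzero gw≄0 min-j
                    ; minimal = min-j ; before = strictly-before }
      where
      open Direction d
      minimal-nonzero : ∀ {w j} → ¬ IsZero (g w) → (∀ k → g j ≼ g k) → ¬ IsZero (g j)
      minimal-nonzero {w} gw≄0 min-j gj≃0 = gw≄0 (zero-≼ gj≃0 (min-j w))
      strictly : ∀ {j k} → (∀ l → g j ≼ g l) → (k ⊏ j → ¬ (∀ l → g k ≼ g l)) → ¬ ¬ (k ⊏ j → g j ≺ g k)
      strictly {j} {k} min-j ¬min-k = do
        comparison ← ≼-total (g k) (g j)
        return λ k⊏j →
          [ (λ gk≼gj → contradiction (λ l → ≼-trans gk≼gj (min-j l)) (¬min-k k⊏j)) , id ]′ comparison

    ¬¬-shape : ∀ d → ¬ ¬ Shape d g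
    ¬¬-shape d = do
      first ← ¬¬-firstNonzero d
      last ← ¬¬-firstNonzero (reverse d)
      lead ← ¬¬-firstMinimal d
      return record { first = first ; last = last ; lead = lead }

  module Factorization (a : ℕ → A) (prim : AlgebraicallyPrimitive _≈_ 0# a) (G H : DirichletPoly)
                       (g-nonconstant : ¬ IsConstant (DirichletPoly.coeff G))
                       (h-nonconstant : ¬ IsConstant (DirichletPoly.coeff H))
                       (factor : ∀ i → ι (a i) ≃ (DirichletPoly.coeff G ⋆ DirichletPoly.coeff H) i) where

    g h : ℕ → Frac
    g = DirichletPoly.coeff G
    h = DirichletPoly.coeff H

    g0≃0 : IsZero (g 0)
    g0≃0 = DirichletPoly.coeff0 G

    h0≃0 : IsZero (h 0)
    h0≃0 = DirichletPoly.coeff0 H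

    φ : ℕ → Frac
    φ i = ι (a i)

    ≼-φ : ∀ {i} → (∀ j k → j ℕ.* k ≡ i → x ≼ g j ⊗ h k) → x ≼ φ i
    ≼-φ {i = i} x≼gh = ≼-respʳ-≃ (sym (factor i)) (⋆-≼ x≼gh)

    vanishes : ∀ {i} → (∀ j k → j ℕ.* k ≡ i → IsZero (g j) ⊎ IsZero (h k)) → a i ≈ 0#
    vanishes zero-term = ι-zero (zero-≼ {x = ι 0#} refl (≼-φ λ j k jk≡i →
      ≼-zero ([ ⊗-zeroˡ {g j} {h k} , ⊗-zeroʳ {h k} {g j} ]′ (zero-term j k jk≡i))))

    positive-product : ∀ {j k} → ¬ IsZero (g j) → ¬ IsZero (h k) → 0 < j ℕ.* k
    positive-product {j} {k} gj≄0 hk≄0 =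
      ℕ.*-monoˡ-< k {{>-nonZero (index-positive {h} h0≃0 hk≄0)}} (index-positive {g} g0≃0 gj≄0)

    dominant-term : ∀ {j* k*} → 0 < j* → 0 < k* → ¬ IsZero (g j* ⊗ h k*) →
                    (∀ j k → j ℕ.* k ≡ j* ℕ.* k* → ¬ (j ≡ j* × k ≡ k*) → g j* ⊗ h k* ≺ g j ⊗ h k) →
                    g j* ⊗ h k* ≼ φ (j* ℕ.* k*) × ¬ g j* ⊗ h k* ≺ φ (j* ℕ.* k*)
    dominant-term {j*} {k*} 0<j* 0<k* x≄0 x≺others = ≼-φ x≼terms , λ (strict p⊙x≼φ) →
      ⋆-dominant 0<j* 0<k* (λ p⊙x≼x → ≺-irrefl x≄0 (strict p⊙x≼x))
        (λ j k jk≡ other → _≺_.unstrict (x≺others j k jk≡ other)) (≼-respʳ-≃ (factor _) p⊙x≼φ)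
      where
      x≼terms : ∀ j k → j ℕ.* k ≡ j* ℕ.* k* → g j* ⊗ h k* ≼ g j ⊗ h k
      x≼terms j k jk≡ with j ℕ.≟ j* | k ℕ.≟ k*
      ... | yes ≡.refl | yes ≡.refl = ≼-refl
      ... | no j≢j*    | _          = ≺⇒≼ (x≺others j k jk≡ λ (j≡j* , _) → j≢j* j≡j*)
      ... | yes _      | no k≢k*    = ≺⇒≼ (x≺others j k jk≡ λ (_ , k≡k*) → k≢k* k≡k*)

    module _ (d : Direction) where
      open Direction d

      extreme-term : ∀ {j* k*} → ¬ IsZero (g j*) → ¬ IsZero (h k*) →
                     (∀ j → j ⊏ j* → ∀ k → g j* ⊗ h k* ≺ g j ⊗ h k) →
                     (∀ k → k ⊏ k* → ∀ j → g j* ⊗ h k* ≺ g j ⊗ h k) →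
                     g j* ⊗ h k* ≼ φ (j* ℕ.* k*) × ¬ g j* ⊗ h k* ≺ φ (j* ℕ.* k*)
      extreme-term {j*} {k*} gj*≄0 hk*≄0 g-before h-before =
        dominant-term (index-positive {g} g0≃0 gj*≄0) (index-positive {h} h0≃0 hk*≄0)
                      (⊗-nonzero {g j*} {h k*} gj*≄0 hk*≄0) x≺others
        where
        x≺others : ∀ j k → j ℕ.* k ≡ j* ℕ.* k* → ¬ (j ≡ j* × k ≡ k*) → g j* ⊗ h k* ≺ g j ⊗ h k
        x≺others j k jk≡ other with j ⊏? j* | k ⊏? k*
        ... | yes j⊏j* | _        = g-before j j⊏j* k
        ... | no _     | yes k⊏k* = h-before k k⊏k* j
        ... | no j⋢j*  | no k⋢k*  =
          contradiction (*-cancel-⊒ j⋢j* k⋢k* jk≡ (≡.subst (0 <_) (≡.sym jk≡) (positive-product gj*≄0 hk*≄0)))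
                        other

      first-nonzero-term : (F : FirstNonzero d g) (F′ : FirstNonzero d h) → let open FirstNonzero in
                           g (index F) ⊗ h (index F′) ≼ φ (index F ℕ.* index F′) ×
                           ¬ g (index F) ⊗ h (index F′) ≺ φ (index F ℕ.* index F′)
      first-nonzero-term F F′ = extreme-term (nonzero F) (nonzero F′)
        (λ j j⊏ k → ≺-zero (⊗-zeroˡ {g j} {h k} (before F j j⊏)))
        (λ k k⊏ j → ≺-zero (⊗-zeroʳ {h k} {g j} (before F′ k k⊏)))
        where open FirstNonzero

      first-minimal-term : (M : FirstMinimal d g) (M′ : FirstMinimal d h) → let open FirstMinimal in
                           ¬ g (index M) ⊗ h (index M′) ≺ φ (index M ℕ.* index M′)
      first-minimal-term M M′ = proj₂ (extreme-term (nonzero M) (nonzero M′)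
        (λ j j⊏ k → ≺-⊗ˡ (before M j j⊏) (minimal M′ k))
        (λ k k⊏ j → ≺-⊗ʳ (minimal M j) (before M′ k k⊏)))
        where open FirstMinimal

      first-nonzero-index : (F : FirstNonzero d g) (F′ : FirstNonzero d h) → ∀ e → ¬ a e ≈ 0# →
                            (∀ i → i ⊏ e → a i ≈ 0#) → FirstNonzero.index F ℕ.* FirstNonzero.index F′ ≡ e
      first-nonzero-index F F′ e ae≉0 before-e with compare (index F ℕ.* index F′) e
        where open FirstNonzero
      ... | tri< E⊏e _ _ = contradiction (≺-zero (*-congʳ (before-e _ E⊏e))) (proj₂ (first-nonzero-term F F′))
      ... | tri≈ _ E≡e _ = E≡e
      ... | tri> _ _ e⊏E = contradiction (vanishes zero-term) ae≉0
        where
        open FirstNonzero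
        zero-term : ∀ j k → j ℕ.* k ≡ e → IsZero (g j) ⊎ IsZero (h k)
        zero-term j k jk≡e with j ⊏? index F | k ⊏? index F′
        ... | yes j⊏ | _      = inj₁ (before F j j⊏)
        ... | no _   | yes k⊏ = inj₂ (before F′ k k⊏)
        ... | no j⋢  | no k⋢  =
          contradiction (≡.subst (_⊏ index F ℕ.* index F′) (≡.sym jk≡e) e⊏E) (*-mono-⊒ j⋢ k⋢)

    divisor-of-support : ∀ M → (∀ j k → ¬ M ∣ℕ j ℕ.* k → IsZero (g j) ⊎ IsZero (h k)) → M ≡ 1
    divisor-of-support M zero-term = prim M λ i ai≉0 → decidable-stable (M ∣ℕ? i) λ M∤i →
      ai≉0 (vanishes λ j k jk≡i → zero-term j k λ M∣jk → M∤i (≡.subst (M ∣ℕ_) jk≡i M∣jk))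

    not-monomialˡ : ∀ M → ¬ (∀ j → j ≢ M → IsZero (g j))
    not-monomialˡ M outside = g-nonconstant λ i i≢1 → outside i λ i≡M → i≢1 (≡.trans i≡M M≡1)
      where
      M≡1 : M ≡ 1
      M≡1 = divisor-of-support M λ j k M∤jk →
        inj₁ (outside j λ j≡M → M∤jk (≡.subst (_∣ℕ j ℕ.* k) j≡M (m∣m*n k)))

    not-monomialʳ : ∀ M → ¬ (∀ k → k ≢ M → IsZero (h k))
    not-monomialʳ M outside = h-nonconstant λ i i≢1 → outside i λ i≡M → i≢1 (≡.trans i≡M M≡1)
      where
      M≡1 : M ≡ 1
      M≡1 = divisor-of-support M λ j k M∤jk →
        inj₂ (outside k λ k≡M → M∤jk (≡.subst (_∣ℕ j ℕ.* k) k≡M (n∣m*n j)))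

    eisenstein : ∀ d → Shape d g → Shape d h → ∀ e e′ → let open Direction d in
                 ¬ a e ≈ 0# → (∀ i → i ⊏ e → a i ≈ 0#) → (∀ i → e′ ⊏ i → a i ≈ 0#) →
                 (∀ i → i ≢ e′ → p ∣ a i) → ¬ p ∣ a e′ → ¬ p * p ∣ a e → ⊥
    eisenstein d Sg Sh e e′ ae≉0 before-e after-e′ p∣a p∤ae′ p²∤ae =
      ¬≺⇒¬¬≽ (first-minimal-term d lead-g lead-h) λ φL≼γ →
        let L≡e′ = lead-product φL≼γ in
        [ lead≢firstˡ L≡e′ , lead≢firstʳ L≡e′ ]′ (lead-at-first (≼-trans ι1≼ι φL≼γ))
      where
      open Direction d
      open Shape Sg renaming (first to first-g; last to last-g; lead to lead-g)
      open Shape Sh renaming (first to first-h; last to last-h; lead to lead-h)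
      open FirstNonzero
      open FirstMinimal using () renaming (index to lead-index)

      γ : Frac
      γ = g (lead-index lead-g) ⊗ h (lead-index lead-h)

      L : ℕ
      L = lead-index lead-g ℕ.* lead-index lead-h

      gauss : ∀ i → γ ≼ φ i
      gauss i = ≼-φ λ j k _ → ≼-⊗ (FirstMinimal.minimal lead-g j) (FirstMinimal.minimal lead-h k)

      E≡e : index first-g ℕ.* index first-h ≡ e
      E≡e = first-nonzero-index d first-g first-h e ae≉0 before-e

      E′≡e′ : index last-g ℕ.* index last-h ≡ e′
      E′≡e′ = first-nonzero-index (reverse d) last-g last-h e′ ae′≉0 after-e′
        where
        ae′≉0 : ¬ a e′ ≈ 0#
        ae′≉0 ae′≈0 = p∤ae′ (∣ʳ-respʳ-≈ (sym ae′≈0) (p ∣0))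

      lead-product : φ L ≼ γ → L ≡ e′
      lead-product φL≼γ with L ℕ.≟ e′
      ... | yes L≡e′ = L≡e′
      ... | no L≢e′  =
        contradiction (ι1≺ι⇒p∣ (≺-≼-trans (≺-≼-trans (p∣⇒ι1≺ι (p∣a L L≢e′)) φL≼γ) (gauss e′))) p∤ae′

      lead-at-first : ι 1# ≼ γ → lead-index lead-g ≡ index first-g ⊎ lead-index lead-h ≡ index first-h
      lead-at-first 1≼γ with lead-index lead-g ℕ.≟ index first-g | lead-index lead-h ℕ.≟ index first-h
      ... | yes ≡g | _      = inj₁ ≡g
      ... | no _   | yes ≡h = inj₂ ≡h
      ... | no ≢g  | no ≢h  =
        contradiction (ι1≺≺ι⇒p²∣ (≼-≺-trans 1≼γ γ≺mixed) (≺-≼-trans mixed≺edge edge≼φe)) p²∤ae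
        where
        mixed edge : Frac
        mixed = g (index first-g) ⊗ h (lead-index lead-h)
        edge = g (index first-g) ⊗ h (index first-h)
        γ≺mixed : γ ≺ mixed
        γ≺mixed = ≺-⊗ˡ (FirstMinimal.before lead-g (index first-g)
                          (index-⊏ first-g (FirstMinimal.nonzero lead-g) ≢g))
                       (≼-refl {x = h (lead-index lead-h)})
        mixed≺edge : mixed ≺ edge
        mixed≺edge = ≺-⊗ʳ (≼-refl {x = g (index first-g)})
                          (FirstMinimal.before lead-h (index first-h)
                            (index-⊏ first-h (FirstMinimal.nonzero lead-h) ≢h))
        edge≼φe : edge ≼ φ e
        edge≼φe = ≡.subst (λ i → edge ≼ φ i) E≡e (proj₁ (first-nonzero-term d first-g first-h))

      lead≢firstˡ : L ≡ e′ → lead-index lead-g ≢ index first-g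
      lead≢firstˡ L≡e′ lead≡first = not-monomialˡ (index first-g) (single-index first-g last-g last≡first)
        where
        last≡first : index last-g ≡ index first-g
        last≡first = proj₁ (*-cancel-⊒
          (λ last⊏first → nonzero first-g (before last-g _ last⊏first))
          (λ last⊏lead → FirstMinimal.nonzero lead-h (before last-h _ last⊏lead))
          (≡.trans E′≡e′ (≡.trans (≡.sym L≡e′) (≡.cong (ℕ._* lead-index lead-h) lead≡first)))
          (positive-product (nonzero last-g) (nonzero last-h)))

      lead≢firstʳ : L ≡ e′ → lead-index lead-h ≢ index first-h
      lead≢firstʳ L≡e′ lead≡first = not-monomialʳ (index first-h) (single-index first-h last-h last≡first)
        where
        last≡first : index last-h ≡ index first-h
        last≡first = proj₂ (*-cancel-⊒
          (λ last⊏lead → FirstMinimal.nonzero lead-g (before last-g _ last⊏lead))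
          (λ last⊏first → nonzero first-h (before last-h _ last⊏first))
          (≡.trans E′≡e′ (≡.trans (≡.sym L≡e′) (≡.cong (lead-index lead-g ℕ.*_) lead≡first)))
          (positive-product (nonzero last-g) (nonzero last-h)))

    divisible-off : ∀ {lo hi} e′ → (∀ i → i < lo → a i ≈ 0#) → (∀ i → hi < i → a i ≈ 0#) →
                    (∀ i → lo ≤ i → i ≤ hi → i ≢ e′ → p ∣ a i) → ∀ i → i ≢ e′ → p ∣ a i
    divisible-off {lo} {hi} e′ below above inside i i≢e′ with i ℕ.<? lo | hi ℕ.<? i
    ... | yes i<lo | _        = ∣ʳ-respʳ-≈ (sym (below i i<lo)) (p ∣0)
    ... | no _     | yes hi<i = ∣ʳ-respʳ-≈ (sym (above i hi<i)) (p ∣0)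
    ... | no i≮lo  | no hi≮i  = inside i (ℕ.≮⇒≥ i≮lo) (ℕ.≮⇒≥ hi≮i) i≢e′

    criterion-i : ∀ {m n} → ¬ a m ≈ 0# → (∀ i → i < m → a i ≈ 0#) → (∀ i → n < i → a i ≈ 0#) →
                  (∀ i → m ≤ i → i < n → p ∣ a i) × ¬ p ∣ a n × ¬ p * p ∣ a m → ⊥
    criterion-i {m} {n} am≉0 below-m above-n (p∣a , p∤an , p²∤am) =
      ¬¬-shape G g-nonconstant ascending λ Sg → ¬¬-shape H h-nonconstant ascending λ Sh →
        eisenstein ascending Sg Sh m n am≉0 below-m above-n
          (divisible-off n below-m above-n λ i m≤i i≤n i≢n → p∣a i m≤i (ℕ.≤∧≢⇒< i≤n i≢n)) p∤an p²∤am

    criterion-ii : ∀ {m n} → ¬ a n ≈ 0# → (∀ i → i < m → a i ≈ 0#) → (∀ i → n < i → a i ≈ 0#) →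
                   (∀ i → m < i → i ≤ n → p ∣ a i) × ¬ p ∣ a m × ¬ p * p ∣ a n → ⊥
    criterion-ii {m} {n} an≉0 below-m above-n (p∣a , p∤am , p²∤an) =
      ¬¬-shape G g-nonconstant descending λ Sg → ¬¬-shape H h-nonconstant descending λ Sh →
        eisenstein descending Sg Sh n m an≉0 above-n below-m
          (divisible-off m below-m above-n λ i m≤i i≤n i≢m → p∣a i (ℕ.≤∧≢⇒< m≤i (i≢m ∘ ≡.sym)) i≤n) p∤am p²∤an

open import Algebra.Definitions.RawSemiring using (_∣_)

theorem2p14 : ∀ {c ℓ} (R : CommutativeRing c ℓ) (ufd : IsUFD R) →
    let open CommutativeRing R renaming (Carrier to A)
        S = RawRing.rawSemiring (CommutativeRing.rawRing R)
    in
    (a : ℕ → A) (m n : ℕ) → 1 ≤ m → m ≤ n →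
    (∀ i → i < m → a i ≈ 0#) → (∀ i → n < i → a i ≈ 0#) →
    ¬ (a m * a n ≈ 0#) →
    AlgebraicallyPrimitive _≈_ 0# a →
    (p : A) → Prime S p →
    ((∀ i → m ≤ i → i < n → _∣_ S p (a i)) × ¬ (_∣_ S p (a n)) × ¬ (_∣_ S (p * p) (a m))
     ⊎
     (∀ i → m < i → i ≤ n → _∣_ S p (a i)) × ¬ (_∣_ S p (a m)) × ¬ (_∣_ S (p * p) (a n))) →
    Dirichlet.IrreducibleOver (Quot.QRawRing R ufd) (λ i → Quot.ι R ufd (a i))
theorem2p14 R ufd a m n _ _ below-m above-n am*an≉0 prim p p-prime hypotheses
            (G , H , g-nonconstant , h-nonconstant , factor) =
  [ criterion-i am≉0 below-m above-n , criterion-ii an≉0 below-m above-n ]′ hypotheses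
  where
  open CommutativeRing R
  open QuotientValuation R ufd p-prime
  open Factorization a prim G H g-nonconstant h-nonconstant factor

  am≉0 : ¬ a m ≈ 0#
  am≉0 am≈0 = am*an≉0 (trans (*-congʳ am≈0) (zeroˡ (a n)))

  an≉0 : ¬ a n ≈ 0#
  an≉0 an≈0 = am*an≉0 (trans (*-congˡ an≈0) (zeroʳ (a m)))
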